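{- Let $M$ be a structure, $\mathcal L\subseteq M$ countable, $<$ a linear order on $\mathcal L$, and $\mathcal P=\{p_1<\dots<p_k\}$ a finite set of non-algebraic complete $1$-types over $(\mathcal L,<)$ such that $(\mathcal L,<)$ is well-ordered and $p_k$ is its $\infty$-type (i.e. $(\mathcal L,<)$ is a quasi-well-ordering of type (a) with respect to $\mathcal P$). Assume that $(\mathcal L,<)$ is an AZ-ordering in $M$ and that every elementary map between subsets of $\mathcal L$ extends to an automorphism of $M$ (for example, $M$ is $\omega_1$-saturated). Then $<$ is nice in $M$ with respect to $\mathcal P$.
   Context: Types are $1$-types over the parameter set $\mathcal L$ in the language of orders; non-algebraic means not containing $x=c$ for $c\in\mathcal L$; $p<q$ iff some $c\in\mathcal L$ has $(x<c)\in p$, $(c<x)\in q$. The $\infty$-type of the well-ordering $\mathcal L$ is $\{c<x:c\in\mathcal L\}$. Let $J_1=\{x\in\mathcal L:(x<y)\in p_1(y)\}$ and $J_l=\{x\in\mathcal L:(y<x)\in p_{l-1}(y),\ (x<y)\in p_l(y)\}$ for $2\le l\le k$. A linear ordering $<$ of a countable subset $\mathcal L\subseteq M$ is an AZ-ordering in $M$ if for every $n\ge1$ and every sequence $\bar b_i$, $i<\omega$, of $n$-tuples from $\mathcal L$ which is not decreasing coordinatewise, there exist $i<j<\omega$ and a $<$-preserving $Th(M)$-elementary map $f:\mathcal L\to\mathcal L$ with $f(\bar b_i)=\bar b_j$. In this situation, $<$ is nice in $M$ with respect to $\mathcal P$ if for every sequence of $k$-tuples $(a^i_1,\dots,a^i_k)$,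 $i<\omega$, with $a^i_l\in J_l$ and $a^1_l\le a^2_l\le\cdots$ for each $l\le k$, there exist $i<j<\omega$ and $\xi\in Aut(M)$ with $\xi(a^i_1,\dots,a^i_k)=(a^j_1,\dots,a^j_k)$ such that for every $l\le k$, $\xi$ maps the initial segment $\{x\in J_l:x<a^i_l\}$ into the initial segment $\{x\in J_l:x<a^j_l\}$. -}

module Defs where

open import Data.Nat using (ℕ; zero; suc; _≤_)
import Data.Nat as ℕ
open import Data.Fin using (Fin; zero; suc; inject₁; fromℕ)
import Data.Fin as Fin
open import Data.Vec.Functional using (_∷_)
open import Data.List using (List)
open import Data.List.Relation.Unary.All using (All)
open import Data.Product using (Σ; ∃; _×_; _,_)
open import Data.Sum using (_⊎_)
open import Data.Empty using (⊥)
open import Data.Unit using (⊤)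
open import Relation.Nullary using (¬_)
open import Relation.Binary.PropositionalEquality using (_≡_)
open import Function using (_∘_)
open import Function.Bundles using (_⇔_; _↔_; Inverse)
open import Function.Definitions using (Injective)
open import Induction.WellFounded using (WellFounded)

record Signature : Set₁ where
  field
    Rel  : Set
    rar  : Rel → ℕ
    Fun  : Set
    far  : Fun → ℕ
open Signature public

record Structure (σ : Signature) : Set₁ where
  field
    Carrier : Set
    relI    : (R : Rel σ) → (Fin (rar σ R) → Carrier) → Set
    funI    : (F : Fun σ) → (Fin (far σ F) → Carrier) → Carrier
open Structure public

data Term (σ : Signature) (n : ℕ) : Set where
  var : Fin n → Term σ n
  app : (F : Fun σ) → (Fin (far σ F) → Term σ n) → Term σ n

data Formula (σ : Signature) : ℕ → Set where
  ⊥f ⊤f   : ∀ {n} → Formula σ n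
  _≐_     : ∀ {n} → Term σ n → Term σ n → Formula σ n
  rel     : ∀ {n} (R : Rel σ) → (Fin (rar σ R) → Term σ n) → Formula σ n
  ¬f_     : ∀ {n} → Formula σ n → Formula σ n
  _∧f_ _∨f_ _⇒f_ : ∀ {n} → Formula σ n → Formula σ n → Formula σ n
  ∀f ∃f   : ∀ {n} → Formula σ (suc n) → Formula σ n

module _ {σ : Signature} (M : Structure σ) where
  evalT : ∀ {n} → Term σ n → (Fin n → Carrier M) → Carrier M
  evalT (var i)    e = e i
  evalT (app F ts) e = funI M F (λ i → evalT (ts i) e)

  Sat : ∀ {n} → Formula σ n → (Fin n → Carrier M) → Set
  Sat ⊥f        e = ⊥
  Sat ⊤f        e = ⊤
  Sat (s ≐ t)   e = evalT s e ≡ evalT t e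
  Sat (rel R ts) e = relI M R (λ i → evalT (ts i) e)
  Sat (¬f φ)    e = ¬ Sat φ e
  Sat (φ ∧f ψ)  e = Sat φ e × Sat ψ e
  Sat (φ ∨f ψ)  e = Sat φ e ⊎ Sat ψ e
  Sat (φ ⇒f ψ)  e = Sat φ e → Sat ψ e
  Sat (∀f φ)    e = ∀ a → Sat φ (a ∷ e)
  Sat (∃f φ)    e = Σ (Carrier M) λ a → Sat φ (a ∷ e)

  IsAutomorphism : (Carrier M ↔ Carrier M) → Set
  IsAutomorphism ξ =
    (∀ (R : Rel σ) (v : Fin (rar σ R) → Carrier M) →
       relI M R v ⇔ relI M R (Inverse.to ξ ∘ v)) ×
    (∀ (F : Fun σ) (v : Fin (far σ F) → Carrier M) →
       Inverse.to ξ (funI M F v) ≡ funI M F (Inverse.to ξ ∘ v))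

  Aut : Set
  Aut = Σ (Carrier M ↔ Carrier M) IsAutomorphism

  aut : Aut → Carrier M → Carrier M
  aut (ξ , _) = Inverse.to ξ

Countable : Set → Set
Countable L = Σ (L → ℕ) Injective'
  where Injective' : (L → ℕ) → Set
        Injective' f = ∀ {x y} → f x ≡ f y → x ≡ y

record IsLinearOrder {L : Set} (_<_ : L → L → Set) : Set where
  field
    irrefl : ∀ x → ¬ (x < x)
    trans  : ∀ {x y z} → x < y → y < z → x < z
    total  : ∀ x y → (x < y) ⊎ (x ≡ y) ⊎ (y < x)

_≤[_]_ : {L : Set} → L → (L → L → Set) → L → Set
x ≤[ _<_ ] y = (x < y) ⊎ (x ≡ y)

IsWellOrder : {L : Set} → (L → L → Set) → Set
IsWellOrder _<_ = IsLinearOrder _<_ × WellFounded _<_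

data OTerm (L : Set) (n : ℕ) : Set where
  ovar   : Fin n → OTerm L n
  oconst : L → OTerm L n

data OFormula (L : Set) : ℕ → Set where
  ⊥o ⊤o     : ∀ {n} → OFormula L n
  _<o_ _=o_ : ∀ {n} → OTerm L n → OTerm L n → OFormula L n
  ¬o_       : ∀ {n} → OFormula L n → OFormula L n
  _∧o_ _∨o_ _⇒o_ : ∀ {n} → OFormula L n → OFormula L n → OFormula L n
  ∀o ∃o     : ∀ {n} → OFormula L (suc n) → OFormula L n

module _ {L : Set} (_<_ : L → L → Set) where
  oeval : ∀ {n} → OTerm L n → (Fin n → L) → L
  oeval (ovar i)   e = e i
  oeval (oconst c) e = c

  OSat : ∀ {n} → OFormula L n → (Fin n → L) → Set
  OSat ⊥o        e = ⊥
  OSat ⊤o        e = ⊤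
  OSat (s <o t)  e = oeval s e < oeval t e
  OSat (s =o t)  e = oeval s e ≡ oeval t e
  OSat (¬o φ)    e = ¬ OSat φ e
  OSat (φ ∧o ψ)  e = OSat φ e × OSat ψ e
  OSat (φ ∨o ψ)  e = OSat φ e ⊎ OSat ψ e
  OSat (φ ⇒o ψ)  e = OSat φ e → OSat ψ e
  OSat (∀o φ)    e = ∀ a → OSat φ (a ∷ e)
  OSat (∃o φ)    e = Σ L λ a → OSat φ (a ∷ e)

  record IsCompleteType (p : OFormula L 1 → Set) : Set where
    field
      complete : ∀ φ → p φ ⊎ p (¬o φ)
      finSat   : ∀ (φs : List (OFormula L 1)) → All p φs →
                 Σ L λ a → All (λ φ → OSat φ (λ _ → a)) φs

  x₀ : OTerm L 1
  x₀ = ovar zero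

  NonAlgebraic : (OFormula L 1 → Set) → Set
  NonAlgebraic p = ∀ c → ¬ p (x₀ =o oconst c)

  _≺_ : (OFormula L 1 → Set) → (OFormula L 1 → Set) → Set
  p ≺ q = Σ L λ c → p (x₀ <o oconst c) × q (oconst c <o x₀)

  IsInftyType : (OFormula L 1 → Set) → Set
  IsInftyType p = ∀ c → p (oconst c <o x₀)

  J : ∀ {k} → (Fin k → OFormula L 1 → Set) → Fin k → L → Set
  J P zero     x = P zero (oconst x <o x₀)
  J P (suc i)  x = P (inject₁' i) (x₀ <o oconst x) × P (suc i) (oconst x <o x₀)
    where inject₁' : ∀ {k} → Fin k → Fin (suc k)
          inject₁' = inject₁

module _ {σ : Signature} (M : Structure σ) {L : Set} (ι : L → Carrier M)
         (_<_ : L → L → Set) where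

  IsElementary : (L → L) → Set
  IsElementary f = ∀ {n} (φ : Formula σ n) (a : Fin n → L) →
                   Sat M φ (ι ∘ a) ⇔ Sat M φ (ι ∘ f ∘ a)

  OrderPreserving : (L → L) → Set
  OrderPreserving f = ∀ {x y} → x < y → f x < f y

  DecreasingCW : ∀ {n} → (ℕ → Fin n → L) → Set
  DecreasingCW b = ∀ i t → b (suc i) t < b i t

  IsAZOrdering : Set
  IsAZOrdering =
    ∀ (n : ℕ) → 1 ≤ n → (b : ℕ → Fin n → L) → ¬ DecreasingCW b →
    Σ ℕ λ i → Σ ℕ λ j → (i ℕ.< j) ×
    Σ (L → L) λ f → OrderPreserving f × IsElementary f ×
      (∀ t → f (b i t) ≡ b j t)

  IsElementaryPartial : (D : L → Set) → ((x : L) → D x → L) → Set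
  IsElementaryPartial D f =
    ∀ {n} (φ : Formula σ n) (a : Fin n → L) (d : ∀ t → D (a t)) →
    Sat M φ (ι ∘ a) ⇔ Sat M φ (λ t → ι (f (a t) (d t)))

  ElementaryMapsExtend : Set₁
  ElementaryMapsExtend =
    ∀ (D : L → Set) (f : (x : L) → D x → L) → IsElementaryPartial D f →
    Σ (Aut M) λ ξ → ∀ x (d : D x) → aut M ξ (ι x) ≡ ι (f x d)

  IsNice : ∀ {k} → (Fin k → OFormula L 1 → Set) → Set
  IsNice {k} P =
    ∀ (a : ℕ → Fin k → L) →
    (∀ i l → J _<_ P l (a i l)) →
    (∀ i l → a i l ≤[ _<_ ] a (suc i) l) →
    Σ ℕ λ i → Σ ℕ λ j → (i ℕ.< j) × Σ (Aut M) λ ξ →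
      (∀ l → aut M ξ (ι (a i l)) ≡ ι (a j l)) ×
      (∀ l x → J _<_ P l x → x < a i l →
         Σ L λ y → J _<_ P l y × y < a j l × aut M ξ (ι x) ≡ ι y)

module Submission where

-- Let a_0, a_1, … be the given sequence of k-tuples with
-- a_i l ∈ J_l, non-decreasing in every coordinate.  Such a sequence is not
-- coordinatewise decreasing, so the AZ-property yields i < j and an
-- order-preserving elementary map f : L → L with f(a_i) = a_j; being total
-- and elementary, f extends to an automorphism ξ of M.  Since L is
-- well-ordered, f is inflationary (x ≤ f x), so for x ∈ J_l with x < a_i l
-- we get x ≤ f x < a_j l; as J_l is convex (a consequence of the types
-- being complete and finitely satisfiable), f x ∈ J_l, which is exactly
-- the required behaviour of ξ on the initial segments of J_l.
--
-- Countability, injectivity of ι,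
-- non-algebraicity, the ordering of the types and the ∞-type hypothesis
-- are not needed for this case.

open import Defs
open import Data.Nat using (ℕ; suc; s≤s; z≤n)
open import Data.Fin using (Fin; fromℕ; _<_; zero; suc)
open import Function.Definitions using (Injective)
open import Relation.Binary.PropositionalEquality using (_≡_; refl; subst; trans; cong)
open import Data.Product using (Σ; _×_; _,_)
open import Data.Sum using (inj₁; inj₂)
open import Data.Empty using (⊥-elim)
open import Data.Unit using (⊤; tt)
open import Data.List using (_∷_; [])
open import Data.List.Relation.Unary.All using (_∷_; [])
open import Relation.Nullary using (¬_)
open import Induction.WellFounded using (WellFounded; Acc; acc)

-- A complete, finitely satisfiable type contains every formula implied in
-- (L,<) by one of its members: otherwise it would contain φ and ¬ψ, which
-- have no common realisation.
type-closed : {L : Set} (_<_ : L → L → Set) {p : OFormula L 1 → Set} →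
              IsCompleteType _<_ p →
              ∀ {φ ψ} → (∀ e → OSat _<_ φ e → OSat _<_ ψ e) → p φ → p ψ
type-closed _<_ ct {φ} {ψ} φ⇒ψ pφ with IsCompleteType.complete ct ψ
... | inj₁ pψ = pψ
... | inj₂ p¬ψ with IsCompleteType.finSat ct (φ ∷ ¬o ψ ∷ []) (pφ ∷ p¬ψ ∷ [])
...   | _ , (sφ ∷ s¬ψ ∷ []) = ⊥-elim (s¬ψ (φ⇒ψ _ sφ))

module LinearOrderFacts {L : Set} {_<_ : L → L → Set} (lo : IsLinearOrder _<_) where
  open IsLinearOrder lo renaming (trans to <-trans)

  _≤_ : L → L → Set
  x ≤ y = x ≤[ _<_ ] y

  <-≤-trans : ∀ {x y z} → x < y → y ≤ z → x < z
  <-≤-trans x<y (inj₁ y<z) = <-trans x<y y<z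
  <-≤-trans x<y (inj₂ refl) = x<y

  ≤-<-trans : ∀ {x y z} → x ≤ y → y < z → x < z
  ≤-<-trans (inj₁ x<y) y<z = <-trans x<y y<z
  ≤-<-trans (inj₂ refl) y<z = y<z

  nondecreasing-not-decreasing :
    ∀ {n} (b : ℕ → Fin n → L) (t : Fin n) →
    (∀ i s → b i s ≤ b (suc i) s) → ¬ (∀ i s → b (suc i) s < b i s)
  nondecreasing-not-decreasing b t b↑ b↓ =
    irrefl (b 0 t) (≤-<-trans (b↑ 0 t) (b↓ 0 t))

  -- On a well-founded linear order an order-preserving map is inflationary:
  -- f x < x would give the infinite descent x > f x > f (f x) > ….
  inflationary : WellFounded _<_ → (f : L → L) → (∀ {x y} → x < y → f x < f y) →
                 ∀ x → x ≤ f x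
  inflationary wf f f-mono x with total x (f x)
  ... | inj₁ x<fx = inj₁ x<fx
  ... | inj₂ (inj₁ x≡fx) = inj₂ x≡fx
  ... | inj₂ (inj₂ fx<x) = ⊥-elim (no-descent x (wf x) fx<x)
    where
      no-descent : ∀ y → Acc _<_ y → ¬ (f y < y)
      no-descent y (acc rs) fy<y = no-descent (f y) (rs fy<y) (f-mono fy<y)

  lowerBound-downward : ∀ {p} → IsCompleteType _<_ p → ∀ {c d} →
                        p (oconst c <o x₀ _<_) → d ≤ c → p (oconst d <o x₀ _<_)
  lowerBound-downward ct c<x d≤c = type-closed _<_ ct (λ _ → ≤-<-trans d≤c) c<x

  upperBound-upward : ∀ {p} → IsCompleteType _<_ p → ∀ {c d} →
                      p (x₀ _<_ <o oconst c) → c ≤ d → p (x₀ _<_ <o oconst d)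
  upperBound-upward ct x<c c≤d = type-closed _<_ ct (λ _ x<c → <-≤-trans x<c c≤d) x<c

  -- Each J_l is convex in (L,<): it is cut out by a lower and an upper
  -- bound condition on complete types.
  J-convex : ∀ {k} (P : Fin k → OFormula L 1 → Set) → (∀ l → IsCompleteType _<_ (P l)) →
             ∀ l {x y b} → J _<_ P l x → J _<_ P l b → x ≤ y → y ≤ b → J _<_ P l y
  J-convex P ct zero _ Jb _ y≤b = lowerBound-downward (ct zero) Jb y≤b
  J-convex P ct (suc l) (x<p , _) (_ , p<b) x≤y y≤b =
    upperBound-upward (ct _) x<p x≤y , lowerBound-downward (ct (suc l)) p<b y≤b

mainTheorem5 : (σ : Signature) (M : Structure σ) (L : Set) (ι : L → Carrier M) →
    Injective _≡_ _≡_ ι → Countable L →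
    (_≺L_ : L → L → Set) → IsWellOrder _≺L_ →
    (m : ℕ) (P : Fin (suc m) → OFormula L 1 → Set) →
    (∀ l → IsCompleteType _≺L_ (P l)) →
    (∀ l → NonAlgebraic _≺L_ (P l)) →
    (∀ l l′ → l < l′ → _≺_ _≺L_ (P l) (P l′)) →
    IsInftyType _≺L_ (P (fromℕ m)) →
    IsAZOrdering M ι _≺L_ →
    ElementaryMapsExtend M ι _≺L_ →
    IsNice M ι _≺L_ P
mainTheorem5 σ M L ι _ _ _≺L_ (lo , wf) m P ct _ _ _ az ext a Ja a↑
  with az (suc m) (s≤s z≤n) a (nondecreasing-not-decreasing a zero a↑)
  where open LinearOrderFacts lo
... | i , j , i<j , f , f-mono , f-elem , fai≡aj
  with ext (λ _ → ⊤) (λ x _ → f x) (λ φ b _ → f-elem φ b)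
... | ξ , ξ-extends-f = i , j , i<j , ξ , ξ-maps-a , ξ-maps-segment
  where
    open LinearOrderFacts lo

    ξ-maps-a : ∀ l → aut M ξ (ι (a i l)) ≡ ι (a j l)
    ξ-maps-a l = trans (ξ-extends-f (a i l) tt) (cong ι (fai≡aj l))

    -- x ≤ f x < a_j l with x, a_j l ∈ J_l, so f x ∈ J_l by convexity.
    ξ-maps-segment : ∀ l x → J _≺L_ P l x → x ≺L a i l →
                     Σ L λ y → J _≺L_ P l y × y ≺L a j l × aut M ξ (ι x) ≡ ι y
    ξ-maps-segment l x Jx x<ai = f x , Jfx , fx<aj , ξ-extends-f x tt
      where
        fx<aj : f x ≺L a j l
        fx<aj = subst (f x ≺L_) (fai≡aj l) (f-mono x<ai)

        Jfx : J _≺L_ P l (f x)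
        Jfx = J-convex P ct l Jx (Ja j l) (inflationary wf f f-mono x) (inj₁ fx<aj)
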